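{- Let $G=(V,E^+,E^-)$ be a signed graph whose underlying unsigned graph $(V,E^+\cup E^-)$ is connected. If $G$ has an offensive alliance $S$ with $\emptyset\neq S\neq V$, then $\Delta^-(G)\geq \left\lceil \frac{\delta^+(G)+1}{2}\right\rceil$.
   Context: A signed graph is a triple $G=(V,E^+,E^-)$ with $V$ finite, $E^+,E^-\subseteq\binom{V}{2}$ and $E^+\cap E^-=\emptyset$ (positive and negative edges). $N^+(v)=\{u: uv\in E^+\}$, $N^-(v)=\{u: uv\in E^-\}$, $N(v)=N^+(v)\cup N^-(v)$; $\deg^+(v)=|N^+(v)|$, $\deg^-(v)=|N^-(v)|$. For $X\subseteq V$, $\deg^+_X(v)=|N^+(v)\cap X|$, $\deg^-_X(v)=|N^-(v)\cap X|$, and $\overline{X}=V\setminus X$. $\delta^+(G)$ is the minimum positive degree and $\Delta^-(G)$ the maximum negative degree over all vertices. For $S\subseteq V$, the boundary is $\partial S=\left(\bigcup_{v\in S}N(v)\right)\setminus S$. A set $S\subseteq V$ is an offensive alliance if for every $v\in\partial S$: (1) $\deg^-_S(v)\geq \deg^+_S(v)$ and (2) $\deg^-_S(v)\geq \deg^+_{\overline S}(v)+1$. -}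

module Defs where

open import Data.Nat using (ℕ; zero; suc; _+_; _≤_; _⊔_; _⊓_)
open import Data.Nat.DivMod using (_/_)
open import Data.Bool using (Bool; true; false; _∨_; _∧_; not; T)
open import Data.Fin using (Fin)
open import Data.List using (List; []; _∷_; filter; length; foldr; map)
open import Data.List.Base using (allFin)
open import Data.Product using (_×_; ∃)
open import Relation.Binary.PropositionalEquality using (_≡_)
open import Relation.Nullary using (¬_)
open import Relation.Nullary.Decidable using (Dec)
open import Data.Bool.Properties using (T?)

record SignedGraph (n : ℕ) : Set where
  field
    pos     : Fin n → Fin n → Bool
    neg     : Fin n → Fin n → Bool
    pos-sym : ∀ u v → pos u v ≡ pos v u
    neg-sym : ∀ u v → neg u v ≡ neg v u
    pos-irr : ∀ v → pos v v ≡ false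
    neg-irr : ∀ v → neg v v ≡ false
    disj    : ∀ u v → pos u v ∧ neg u v ≡ false

open SignedGraph public

VSet : ℕ → Set
VSet n = Fin n → Bool

_∈ₛ_ : ∀ {n} → Fin n → VSet n → Set
v ∈ₛ S = T (S v)

count : ∀ {n} → (Fin n → Bool) → ℕ
count {n} p = length (filter (λ u → T? (p u)) (allFin n))

degPosIn : ∀ {n} → SignedGraph n → VSet n → Fin n → ℕ
degPosIn G X v = count (λ u → pos G v u ∧ X u)

degNegIn : ∀ {n} → SignedGraph n → VSet n → Fin n → ℕ
degNegIn G X v = count (λ u → neg G v u ∧ X u)

full : ∀ {n} → VSet n
full _ = true

compl : ∀ {n} → VSet n → VSet n
compl X u = not (X u)

degPos : ∀ {n} → SignedGraph n → Fin n → ℕ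
degPos G = degPosIn G full

degNeg : ∀ {n} → SignedGraph n → Fin n → ℕ
degNeg G = degNegIn G full

adj : ∀ {n} → SignedGraph n → Fin n → Fin n → Bool
adj G u v = pos G u v ∨ neg G u v

-- Δ⁻(G): maximum negative degree (0 on the empty graph)
maxNegDeg : ∀ {n} → SignedGraph n → ℕ
maxNegDeg {n} G = foldr _⊔_ 0 (map (degNeg G) (allFin n))

minPosDeg : ∀ {n} → SignedGraph (suc n) → ℕ
minPosDeg {n} G = foldr _⊓_ (degPos G Fin.zero) (map (degPos G) (allFin (suc n)))

data Walk {n} (G : SignedGraph n) : Fin n → Fin n → Set where
  here : ∀ {v} → Walk G v v
  step : ∀ {u v w} → T (adj G u v) → Walk G v w → Walk G u w

Connected : ∀ {n} → SignedGraph n → Set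
Connected {n} G = ∀ (u v : Fin n) → Walk G u v

InBoundary : ∀ {n} → SignedGraph n → VSet n → Fin n → Set
InBoundary G S v = ¬ (v ∈ₛ S) × ∃ λ u → u ∈ₛ S × T (adj G v u)

OffensiveAlliance : ∀ {n} → SignedGraph n → VSet n → Set
OffensiveAlliance G S =
  ∀ v → InBoundary G S v →
    (degPosIn G S v ≤ degNegIn G S v) ×
    (suc (degPosIn G (compl S) v) ≤ degNegIn G S v)

-- ⌈ m / 2 ⌉ = ⌊ (m + 1) / 2 ⌋
ceilHalf : ℕ → ℕ
ceilHalf m = (m + 1) / 2

-- At a vertex v of the boundary, condition (1) gives deg⁺_S(v) ≤ deg⁻_S(v) and
-- condition (2) gives deg⁺_S̄(v) < deg⁻_S(v); adding them, δ⁺ ≤ deg⁺(v) < 2 deg⁻_S(v),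
-- so deg⁻_S(v) ≥ ⌈(δ⁺ + 1)/2⌉, and Δ⁻ ≥ deg⁻(v) ≥ deg⁻_S(v).  Such a vertex exists
-- because a walk from a vertex of S to a vertex outside S must leave S somewhere.
module Submission where

open import Defs
open import Data.Nat using (ℕ; suc; _≤_; _<_; _+_; _*_; _⊔_; _⊓_; s≤s; s≤s⁻¹)
open import Data.Nat.Properties
open import Data.Nat.DivMod using (m<n*o⇒m/o<n)
open import Data.Bool using (Bool; true; false; _∧_; not; T)
open import Data.Bool.Properties using (T?; T-∧; ∧-identityʳ)
open import Data.List using (List; []; _∷_; filter; length; foldr; map; allFin)
open import Data.List.Membership.Propositional using (_∈_)
open import Data.List.Membership.Propositional.Properties using (∈-allFin)
open import Data.List.Relation.Unary.Any using (here; there)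
open import Data.List.Relation.Binary.Sublist.Propositional.Properties
  using (filter⁺; length-mono-≤)
open import Data.List.Relation.Binary.Sublist.Propositional using (⊆-refl)
open import Data.Product using (∃; _,_; proj₁)
open import Data.Empty using (⊥-elim)
open import Function using (_∘_; Equivalence)
open import Relation.Nullary using (¬_)
open import Relation.Binary.PropositionalEquality

private
  variable
    A : Set

countIn : List A → (A → Bool) → ℕ
countIn xs p = length (filter (T? ∘ p) xs)

countIn-mono : ∀ xs {p q : A → Bool} → (∀ {u} → T (p u) → T (q u)) →
  countIn xs p ≤ countIn xs q
countIn-mono xs p⇒q = length-mono-≤ (filter⁺ (T? ∘ _) (T? ∘ _) (λ { refl → p⇒q }) (⊆-refl {x = xs}))

countIn-∧-split : ∀ xs (p s : A → Bool) →
  countIn xs p ≡ countIn xs (λ u → p u ∧ s u) + countIn xs (λ u → p u ∧ not (s u))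
countIn-∧-split []       p s = refl
countIn-∧-split (x ∷ xs) p s with p x | s x
... | false | _     = countIn-∧-split xs p s
... | true  | true  = cong suc (countIn-∧-split xs p s)
... | true  | false = trans (cong suc (countIn-∧-split xs p s)) (sym (+-suc _ _))

foldr-⊓-≤ : ∀ (f : A → ℕ) {b} {x} xs → x ∈ xs → foldr _⊓_ b (map f xs) ≤ f x
foldr-⊓-≤ f (y ∷ xs) (here refl) = m⊓n≤m _ _
foldr-⊓-≤ f (y ∷ xs) (there x∈xs) = ≤-trans (m⊓n≤n (f y) _) (foldr-⊓-≤ f xs x∈xs)

≤-foldr-⊔ : ∀ (f : A → ℕ) {x} xs → x ∈ xs → f x ≤ foldr _⊔_ 0 (map f xs)
≤-foldr-⊔ f (y ∷ xs) (here refl) = m≤m⊔n _ _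
≤-foldr-⊔ f (y ∷ xs) (there x∈xs) = ≤-trans (≤-foldr-⊔ f xs x∈xs) (m≤n⊔m (f y) _)

ceilHalf-≤ : ∀ {m a} → m ≤ a + a → ceilHalf m ≤ a
ceilHalf-≤ {m} {a} m≤a+a = s≤s⁻¹ (m<n*o⇒m/o<n (begin-strict
  m + 1        ≡⟨ +-comm m 1 ⟩
  suc m        <⟨ s≤s (s≤s m≤a+a) ⟩
  2 + (a + a)  ≡⟨ cong (λ k → 2 + (a + k)) (sym (+-identityʳ a)) ⟩
  2 + 2 * a    ≡⟨ cong (2 +_) (*-comm 2 a) ⟩
  suc a * 2    ∎))
  where open ≤-Reasoning

module _ {n} (G : SignedGraph n) where

  adj-sym : ∀ u v → adj G u v ≡ adj G v u
  adj-sym u v rewrite pos-sym G u v | neg-sym G u v = refl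

  walk-crosses-boundary : ∀ (S : VSet n) {s w} → Walk G s w →
    s ∈ₛ S → ¬ (w ∈ₛ S) → ∃ (InBoundary G S)
  walk-crosses-boundary S here s∈S w∉S = ⊥-elim (w∉S s∈S)
  walk-crosses-boundary S (step {u} {v} u~v walk) u∈S w∉S with S v in Sv
  ... | true  = walk-crosses-boundary S walk (subst T (sym Sv) _) w∉S
  ... | false = v , subst T Sv , u , u∈S , subst T (adj-sym u v) u~v

  degPos-≤-split : ∀ (S : VSet n) v → degPos G v ≤ degPosIn G S v + degPosIn G (compl S) v
  degPos-≤-split S v = begin
    degPos G v                               ≤⟨ countIn-mono (allFin n) (subst T (∧-identityʳ _)) ⟩
    countIn (allFin n) (pos G v)             ≡⟨ countIn-∧-split (allFin n) (pos G v) S ⟩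
    degPosIn G S v + degPosIn G (compl S) v  ∎
    where open ≤-Reasoning

  degNegIn-≤-degNeg : ∀ (S : VSet n) v → degNegIn G S v ≤ degNeg G v
  degNegIn-≤-degNeg S v =
    countIn-mono (allFin n) (subst T (sym (∧-identityʳ _)) ∘ proj₁ ∘ Equivalence.to T-∧)

  degNeg-≤-maxNegDeg : ∀ v → degNeg G v ≤ maxNegDeg G
  degNeg-≤-maxNegDeg v = ≤-foldr-⊔ (degNeg G) (allFin n) (∈-allFin v)

  boundary-degPos<degNegIn+degNegIn : ∀ {S : VSet n} {v} → OffensiveAlliance G S → InBoundary G S v →
    degPos G v < degNegIn G S v + degNegIn G S v
  boundary-degPos<degNegIn+degNegIn {S} {v} alliance v∈∂S with alliance v v∈∂S
  ... | outnumbers-S , outnumbers-S̄ = begin-strict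
    degPos G v                               ≤⟨ degPos-≤-split S v ⟩
    degPosIn G S v + degPosIn G (compl S) v  <⟨ +-monoʳ-< (degPosIn G S v) outnumbers-S̄ ⟩
    degPosIn G S v + degNegIn G S v          ≤⟨ +-monoˡ-≤ _ outnumbers-S ⟩
    degNegIn G S v + degNegIn G S v          ∎
    where open ≤-Reasoning

minPosDeg-≤ : ∀ {n} (G : SignedGraph (suc n)) v → minPosDeg G ≤ degPos G v
minPosDeg-≤ {n} G v = foldr-⊓-≤ (degPos G) (allFin (suc n)) (∈-allFin v)

mainTheorem1 : ∀ (n : ℕ) (G : SignedGraph (suc n)) (S : VSet (suc n)) →
    Connected G →
    (∃ λ v → v ∈ₛ S) →
    (∃ λ w → ¬ (w ∈ₛ S)) →
    OffensiveAlliance G S →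
    ceilHalf (minPosDeg G + 1) ≤ maxNegDeg G
mainTheorem1 n G S connected (s , s∈S) (w , w∉S) alliance
  with walk-crosses-boundary G S (connected s w) s∈S w∉S
... | v , v∈∂S = begin
  ceilHalf (minPosDeg G + 1) ≤⟨ ceilHalf-≤ δ⁺+1≤2a ⟩
  degNegIn G S v             ≤⟨ degNegIn-≤-degNeg G S v ⟩
  degNeg G v                 ≤⟨ degNeg-≤-maxNegDeg G v ⟩
  maxNegDeg G                ∎
  where
  open ≤-Reasoning
  δ⁺+1≤2a : minPosDeg G + 1 ≤ degNegIn G S v + degNegIn G S v
  δ⁺+1≤2a = begin
    minPosDeg G + 1                  ≡⟨ +-comm (minPosDeg G) 1 ⟩
    suc (minPosDeg G)                ≤⟨ s≤s (minPosDeg-≤ G v) ⟩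
    suc (degPos G v)                 ≤⟨ boundary-degPos<degNegIn+degNegIn G alliance v∈∂S ⟩
    degNegIn G S v + degNegIn G S v  ∎
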